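{- Let $G$ be a strongly connected swap digraph and let $\mathbb P$ be a swap protocol for $G$ that is live and safe. Then $\mathbb P$ is atomic (i.e., it also has the strong Nash equilibrium property).
   Context: Swap model: vertices of $G$ are parties, each arc $(u,v)$ an asset of $u$ to be transferred to $v$; after any execution each asset $(u,v)$ ends with $u$ or with $v$. An honest (conforming) party follows the protocol until it infers that not all parties do so. An outcome of party $v$ is $(I,O)$ with $I$ the set of incoming arcs whose assets $v$ acquired and $O$ the set of outgoing arcs whose assets $v$ relinquished; acceptable if $I$ equals all incoming arcs of $v$ or $O=\emptyset$. Deal = all incoming acquired and all outgoing relinquished; NoDeal $=(\emptyset,\emptyset)$; Discount = all incoming acquired but not all outgoing relinquished; FreeRide = $O=\emptyset$ and $I\ne\emptyset$; all other outcomes are Underwater. For a set $C$ of parties, incoming/outgoing arcs are those entering/leaving $C$, and outcomes, acceptability and the types above are defined analogously. Each party (and coalition) has a preference relation: a partial order on outcomes with (p1) $(I_2,O_2)$ preferred to $(I_1,O_1)$ whenever $I_1\subseteq I_2$, $O_1\supseteq O_2$; (p2) NoDeal preferred to every Underwater outcome; (p3) Deal preferred to NoDeal. Live: if all parties follow $\mathbb P$, every party ends in Deal. Safe: every honest party ends in an acceptable outcome regardless of others' behavior. Strong Nash equilibrium: for every coalition $C$, if all parties outside $C$ follow $\mathbb P$, the parties in $C$ cannot obtain an outcome of $C$ preferred to the one from following $\mathbb P$. Atomic: live, safe and strong Nash. -}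

module Defs where

open import Data.Nat using (ℕ)
open import Data.Fin using (Fin)
open import Data.Fin.Subset using (Subset; _∈_; _∉_; _⊆_; ⊥; ⁅_⁆; _∩_)
open import Data.Bool using (Bool; true; false; _∧_; not)
open import Data.Vec.Base using (tabulate; lookup)
open import Data.Product using (_×_; _,_; proj₁; proj₂)
open import Data.Sum using (_⊎_)
open import Relation.Nullary using (¬_)
open import Relation.Binary.PropositionalEquality using (_≡_; _≢_)
open import Relation.Binary.Structures using (IsPartialOrder)

-- Swap digraphs: parties Fin n, arcs Fin m (each arc = one asset),
-- simple digraph (no self loops, no parallel arcs).

record SwapDigraph : Set where
  field
    n m     : ℕ
    src tgt : Fin m → Fin n
    noLoops    : ∀ a → src a ≢ tgt a
    noParallel : ∀ a b → src a ≡ src b → tgt a ≡ tgt b → a ≡ b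

module _ (G : SwapDigraph) where
  open SwapDigraph G

  data Path : Fin n → Fin n → Set where
    here : ∀ {u} → Path u u
    step : ∀ {v} (a : Fin m) → Path (tgt a) v → Path (src a) v

  StronglyConnected : Set
  StronglyConnected = ∀ u v → Path u v

  -- A final state: for each arc (u,v), true iff its asset ended with v
  -- (was transferred), false iff it ended with u.
  State : Set
  State = Subset m

  inArcs : Subset n → Subset m
  inArcs C = tabulate (λ a → lookup C (tgt a) ∧ not (lookup C (src a)))

  outArcs : Subset n → Subset m
  outArcs C = tabulate (λ a → lookup C (src a) ∧ not (lookup C (tgt a)))

  -- an outcome (I , O): I acquired incoming arcs, O relinquished outgoing arcs
  Outcome : Set
  Outcome = Subset m × Subset m

  outcome : Subset n → State → Outcome
  outcome C s = (s ∩ inArcs C , s ∩ outArcs C)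

  IsOutcome : Subset n → Outcome → Set
  IsOutcome C o = proj₁ o ⊆ inArcs C × proj₂ o ⊆ outArcs C

  Deal : Subset n → Outcome
  Deal C = (inArcs C , outArcs C)

  NoDeal : Outcome
  NoDeal = (⊥ , ⊥)

  IsDeal : Subset n → Outcome → Set
  IsDeal C o = o ≡ Deal C

  IsNoDeal : Outcome → Set
  IsNoDeal o = o ≡ NoDeal

  IsDiscount : Subset n → Outcome → Set
  IsDiscount C o = proj₁ o ≡ inArcs C × proj₂ o ≢ outArcs C

  IsFreeRide : Outcome → Set
  IsFreeRide o = proj₂ o ≡ ⊥ × proj₁ o ≢ ⊥

  IsUnderwater : Subset n → Outcome → Set
  IsUnderwater C o = ¬ (IsDeal C o ⊎ IsNoDeal o ⊎ IsDiscount C o ⊎ IsFreeRide o)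

  Acceptable : Subset n → Outcome → Set
  Acceptable C o = proj₁ o ≡ inArcs C ⊎ proj₂ o ≡ ⊥

  -- Preference relation of a coalition C: x ≼ y means "y is preferred to x"
  -- (non-strict); a partial order satisfying (p1)-(p3) on outcomes of C.
  record Preference (C : Subset n) : Set₁ where
    field
      _≼_            : Outcome → Outcome → Set
      isPartialOrder : IsPartialOrder _≡_ _≼_
      p1 : ∀ {I₁ O₁ I₂ O₂} → IsOutcome C (I₁ , O₁) → IsOutcome C (I₂ , O₂) →
           I₁ ⊆ I₂ → O₂ ⊆ O₁ → (I₁ , O₁) ≼ (I₂ , O₂)
      p2 : ∀ o → IsOutcome C o → IsUnderwater C o → o ≼ NoDeal
      p3 : NoDeal ≼ Deal C

    _≺_ : Outcome → Outcome → Set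
    x ≺ y = x ≼ y × x ≢ y

  -- A swap protocol, abstracted as a game form: each party has a set of
  -- possible behaviours (strategies), the protocol prescribes the
  -- conforming one, and Execution σ s says that under strategy profile σ
  -- the execution may terminate in final state s.
  record Protocol : Set₁ where
    field
      Strategy  : Fin n → Set
      conform   : (v : Fin n) → Strategy v
      Execution : ((v : Fin n) → Strategy v) → State → Set

  module _ (P : Protocol) where
    open Protocol P

    Profile : Set
    Profile = (v : Fin n) → Strategy v

    Live : Set
    Live = ∀ s → Execution conform s → ∀ v → outcome ⁅ v ⁆ s ≡ Deal ⁅ v ⁆

    Safe : Set
    Safe = ∀ (σ : Profile) s → Execution σ s →
           ∀ v → σ v ≡ conform v → Acceptable ⁅ v ⁆ (outcome ⁅ v ⁆ s)

    StrongNash : Set₁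
    StrongNash = ∀ (C : Subset n) (pref : Preference C) (σ : Profile) →
                 (∀ v → v ∉ C → σ v ≡ conform v) →
                 ∀ s → Execution σ s → ∀ s₀ → Execution conform s₀ →
                 ¬ (Preference._≺_ pref (outcome C s₀) (outcome C s))

    Atomic : Set₁
    Atomic = Live × Safe × StrongNash

-- Liveness makes every asset change hands under the conforming profile, so the
-- conforming outcome of a coalition C is Deal. By (p2) and (p3), NoDeal and every
-- Underwater outcome lie below Deal, so only a Discount or a FreeRide could
-- improve on it. By safety, each conforming party outside C either acquires all
-- its incoming assets or relinquishes none of its outgoing ones: an unacquired
-- asset makes its outside recipient withhold everything it owes, and a
-- relinquished asset makes its outside sender acquire everything it is owed.
-- Following a path (strong connectivity) from the head of an unacquired arc
-- leaving C back into C therefore yields an unacquired arc entering C, ruling out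
-- Discount; following one backwards, i.e. in the reversed digraph, from the tail
-- of a relinquished arc entering C yields a relinquished arc leaving C, ruling
-- out FreeRide.
module Submission where

open import Defs
open import Data.Bool using (true; false; _∧_; not)
open import Data.Bool.Properties using (¬-not)
open import Data.Empty using (⊥-elim)
open import Data.Fin using (Fin)
open import Data.Fin.Subset using (Subset; _∈_; _∉_; _⊆_; _∩_; ∁; ⁅_⁆; ⊤; ⊥)
open import Data.Fin.Subset.Properties
  using (_∈?_; ⊆-antisym; ⊆⊤; ⊥⊆; p∩q⊆q; x∈p∩q⁺; x∈p∩q⁻; ∩-identityˡ;
         x∈⁅x⁆; x≢y⇒x∉⁅y⁆; ∉⊥; x∈∁p⇒x∉p; x∉p⇒x∈∁p)
open import Data.Nat using (ℕ)
open import Data.Product using (_×_; _,_; proj₁; ∃)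
open import Data.Sum using (_⊎_; inj₁; inj₂; [_,_]′)
open import Data.Vec using (lookup)
open import Data.Vec.Properties using (lookup∘tabulate; []=⇒lookup; lookup⇒[]=)
open import Function using (_∘_)
open import Relation.Binary.PropositionalEquality
  using (_≡_; refl; sym; trans; cong; cong₂; subst)
open import Relation.Binary.Definitions using (DecidableEquality)
open import Relation.Binary.Structures using (IsPartialOrder)
open import Relation.Nullary using (¬_; yes; no)
open import Relation.Nullary.Decidable using (decidable-stable)
import Data.Bool as Bool
import Data.Product.Properties as Product
import Data.Vec.Properties as Vec

private
  variable
    k : ℕ
    x : Fin k
    p q : Subset k

∉⇒lookup≡false : x ∉ p → lookup p x ≡ false
∉⇒lookup≡false {x = x} {p = p} x∉p = ¬-not (x∉p ∘ lookup⇒[]= x p)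

lookup≡false⇒∉ : lookup p x ≡ false → x ∉ p
lookup≡false⇒∉ p[x]≡false x∈p with () ← trans (sym ([]=⇒lookup x∈p)) p[x]≡false

∧-not≡true : ∀ {b c} → b ∧ not c ≡ true → b ≡ true × c ≡ false
∧-not≡true {true}  {false} refl = refl , refl
∧-not≡true {true}  {true}  ()
∧-not≡true {false}         ()

p∩q≡q⇒q⊆p : p ∩ q ≡ q → q ⊆ p
p∩q≡q⇒q⊆p {p = p} {q = q} p∩q≡q x∈q =
  proj₁ (x∈p∩q⁻ p q (subst (_ ∈_) (sym p∩q≡q) x∈q))

q⊆p⇒p∩q≡q : q ⊆ p → p ∩ q ≡ q
q⊆p⇒p∩q≡q {q = q} {p = p} q⊆p = ⊆-antisym (p∩q⊆q p q) (λ x∈q → x∈p∩q⁺ (q⊆p x∈q , x∈q))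

p∩q≡⊥⇒q⊆∁p : p ∩ q ≡ ⊥ → q ⊆ ∁ p
p∩q≡⊥⇒q⊆∁p p∩q≡⊥ x∈q = x∉p⇒x∈∁p λ x∈p → ∉⊥ (subst (_ ∈_) p∩q≡⊥ (x∈p∩q⁺ (x∈p , x∈q)))

q⊆∁p⇒p∩q≡⊥ : q ⊆ ∁ p → p ∩ q ≡ ⊥
q⊆∁p⇒p∩q≡⊥ {q = q} {p = p} q⊆∁p = ⊆-antisym p∩q⊆⊥ ⊥⊆
  where
  p∩q⊆⊥ : p ∩ q ⊆ ⊥
  p∩q⊆⊥ x∈p∩q with x∈p , x∈q ← x∈p∩q⁻ p q x∈p∩q = ⊥-elim (x∈∁p⇒x∉p (q⊆∁p x∈q) x∈p)

_≟_ : DecidableEquality (Subset k × Subset k)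
_≟_ = Product.≡-dec (Vec.≡-dec Bool._≟_) (Vec.≡-dec Bool._≟_)

-- outArcs G C is definitionally inArcs (reverse G) C, so each lemma about
-- inArcs below is also used, at reverse G, for outArcs.
reverse : SwapDigraph → SwapDigraph
reverse G = record
  { n = n ; m = m ; src = tgt ; tgt = src
  ; noLoops = λ a → noLoops a ∘ sym
  ; noParallel = λ a b tgt≡ src≡ → noParallel a b src≡ tgt≡
  }
  where open SwapDigraph G

module _ {G : SwapDigraph} where

  _++_ : ∀ {u v w} → Path G u v → Path G v w → Path G u w
  here     ++ q = q
  step a p ++ q = step a (p ++ q)

reverse-path : ∀ {G u v} → Path G u v → Path (reverse G) v u
reverse-path here       = here
reverse-path (step a p) = reverse-path p ++ step a here

module _ (G : SwapDigraph) where
  open SwapDigraph G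

  ∈-inArcs⁺ : ∀ {C a} → tgt a ∈ C → src a ∉ C → a ∈ inArcs G C
  ∈-inArcs⁺ {C} {a} tgt∈C src∉C = lookup⇒[]= a (inArcs G C)
    (trans (lookup∘tabulate _ a) (cong₂ (λ b c → b ∧ not c) ([]=⇒lookup tgt∈C) (∉⇒lookup≡false src∉C)))

  ∈-inArcs⁻ : ∀ {C a} → a ∈ inArcs G C → tgt a ∈ C × src a ∉ C
  ∈-inArcs⁻ {C} {a} a∈inArcs
    with C[tgt]≡true , C[src]≡false ← ∧-not≡true (trans (sym (lookup∘tabulate _ a)) ([]=⇒lookup a∈inArcs))
    = lookup⇒[]= (tgt a) C C[tgt]≡true , lookup≡false⇒∉ C[src]≡false

  ∈-inArcs-⁅⁆ : ∀ {x a} → tgt a ≡ x → a ∈ inArcs G ⁅ x ⁆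
  ∈-inArcs-⁅⁆ {a = a} refl = ∈-inArcs⁺ (x∈⁅x⁆ (tgt a)) (x≢y⇒x∉⁅y⁆ (noLoops a))

  module _ (C : Subset n) where

    PreservedOutside : (Fin m → Set) → Set
    PreservedOutside Q = ∀ {a b} → Q a → tgt a ≡ src b → src b ∉ C → Q b

    reaches-inArcs : ∀ {Q} → PreservedOutside Q → ∀ {x y} → Path G x y → x ∉ C → y ∈ C →
                     ∀ {a} → Q a → tgt a ≡ x → ∃ λ b → b ∈ inArcs G C × Q b
    reaches-inArcs preserved here x∉C y∈C _ _ = ⊥-elim (x∉C y∈C)
    reaches-inArcs preserved (step b p) x∉C y∈C Qa a↦b
      with Qb ← preserved Qa a↦b x∉C | tgt b ∈? C
    ... | yes tgt∈C = b , ∈-inArcs⁺ tgt∈C x∉C , Qb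
    ... | no  tgt∉C = reaches-inArcs preserved p tgt∉C y∈C Qb refl

module _ (G : SwapDigraph) where
  open SwapDigraph G

  acquires-all⊎relinquishes-none : ∀ {s x} → Acceptable G ⁅ x ⁆ (outcome G ⁅ x ⁆ s) →
    (∀ {a} → tgt a ≡ x → a ∈ s) ⊎ (∀ {a} → src a ≡ x → a ∉ s)
  acquires-all⊎relinquishes-none (inj₁ I≡inArcs) = inj₁ (p∩q≡q⇒q⊆p I≡inArcs ∘ ∈-inArcs-⁅⁆ G)
  acquires-all⊎relinquishes-none (inj₂ O≡⊥) =
    inj₂ (x∈∁p⇒x∉p ∘ p∩q≡⊥⇒q⊆∁p O≡⊥ ∘ ∈-inArcs-⁅⁆ (reverse G))

  module _ {C : Subset n} {s : State G}
           (outside-acceptable : ∀ x → x ∉ C → Acceptable G ⁅ x ⁆ (outcome G ⁅ x ⁆ s)) where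

    unacquired-preserved : PreservedOutside G C (_∉ s)
    unacquired-preserved a∉s a↦b src∉C
      with acquires-all⊎relinquishes-none (outside-acceptable _ src∉C)
    ... | inj₁ acquires-all      = ⊥-elim (a∉s (acquires-all a↦b))
    ... | inj₂ relinquishes-none = relinquishes-none refl

    relinquished-preserved-backwards : PreservedOutside (reverse G) C (_∈ s)
    relinquished-preserved-backwards a∈s b↦a tgt∉C
      with acquires-all⊎relinquishes-none (outside-acceptable _ tgt∉C)
    ... | inj₁ acquires-all      = acquires-all refl
    ... | inj₂ relinquishes-none = ⊥-elim (relinquishes-none b↦a a∈s)

    ¬Discount : StronglyConnected G → ¬ IsDiscount G C (outcome G C s)
    ¬Discount sc (I≡inArcs , O≢outArcs) = O≢outArcs (q⊆p⇒p∩q≡q outArcs⊆s)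
      where
      outArcs⊆s : outArcs G C ⊆ s
      outArcs⊆s {a} a∈outArcs = decidable-stable (a ∈? s) λ a∉s →
        let src∈C , tgt∉C = ∈-inArcs⁻ (reverse G) a∈outArcs
            b , b∈inArcs , b∉s = reaches-inArcs G C unacquired-preserved
                                   (sc (tgt a) (src a)) tgt∉C src∈C a∉s refl
        in b∉s (p∩q≡q⇒q⊆p I≡inArcs b∈inArcs)

    ¬FreeRide : StronglyConnected G → ¬ IsFreeRide G (outcome G C s)
    ¬FreeRide sc (O≡⊥ , I≢⊥) = I≢⊥ (q⊆∁p⇒p∩q≡⊥ inArcs⊆∁s)
      where
      inArcs⊆∁s : inArcs G C ⊆ ∁ s
      inArcs⊆∁s {a} a∈inArcs = x∉p⇒x∈∁p λ a∈s →
        let tgt∈C , src∉C = ∈-inArcs⁻ G a∈inArcs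
            b , b∈outArcs , b∈s = reaches-inArcs (reverse G) C relinquished-preserved-backwards
                                    (reverse-path (sc (tgt a) (src a))) src∉C tgt∈C a∈s refl
        in x∈∁p⇒x∉p (p∩q≡⊥⇒q⊆∁p O≡⊥ b∈outArcs) b∈s

module _ (G : SwapDigraph) where

  outcome-isOutcome : ∀ C s → IsOutcome G C (outcome G C s)
  outcome-isOutcome C s = p∩q⊆q s (inArcs G C) , p∩q⊆q s (outArcs G C)

  outcome-⊤ : ∀ C → outcome G C ⊤ ≡ Deal G C
  outcome-⊤ C = cong₂ _,_ (∩-identityˡ (inArcs G C)) (∩-identityˡ (outArcs G C))

module _ {G : SwapDigraph} {C : Subset (SwapDigraph.n G)} (pref : Preference G C) where
  open Preference pref
  open IsPartialOrder isPartialOrder using (reflexive; antisym) renaming (trans to ≼-trans)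

  ≼NoDeal : ∀ {o} → IsOutcome G C o → ¬ IsDeal G C o → ¬ IsDiscount G C o → ¬ IsFreeRide G o →
            o ≼ NoDeal G
  ≼NoDeal {o} isOutcome ¬deal ¬discount ¬freeRide with o ≟ NoDeal G
  ... | yes o≡NoDeal = reflexive o≡NoDeal
  ... | no  o≢NoDeal = p2 o isOutcome [ ¬deal , [ o≢NoDeal , [ ¬discount , ¬freeRide ]′ ]′ ]′

  Deal-unimprovable : ∀ {o} → IsOutcome G C o → ¬ IsDiscount G C o → ¬ IsFreeRide G o →
                      ¬ (Deal G C ≺ o)
  Deal-unimprovable isOutcome ¬discount ¬freeRide (Deal≼o , Deal≢o) =
    Deal≢o (antisym Deal≼o (≼-trans (≼NoDeal isOutcome (Deal≢o ∘ sym) ¬discount ¬freeRide) p3))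

module _ {G : SwapDigraph} (P : Protocol G) where
  open SwapDigraph G
  open Protocol P

  live⇒conforming-state≡⊤ : Live G P → ∀ {s₀} → Execution conform s₀ → s₀ ≡ ⊤
  live⇒conforming-state≡⊤ live {s₀} exec₀ = ⊆-antisym ⊆⊤ λ {a} _ →
    p∩q≡q⇒q⊆p (cong proj₁ (live s₀ exec₀ (tgt a))) (∈-inArcs-⁅⁆ G refl)

  strongNash : StronglyConnected G → Live G P → Safe G P → StrongNash G P
  strongNash sc live safe C pref σ conform-outside s exec s₀ exec₀ Deal≺o =
    Deal-unimprovable pref (outcome-isOutcome G C s)
      (¬Discount G outside-acceptable sc) (¬FreeRide G outside-acceptable sc)
      (subst (_≺ outcome G C s) conforming-outcome≡Deal Deal≺o)
    where
    open Preference pref using (_≺_)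

    outside-acceptable : ∀ x → x ∉ C → Acceptable G ⁅ x ⁆ (outcome G ⁅ x ⁆ s)
    outside-acceptable x x∉C = safe σ s exec x (conform-outside x x∉C)

    conforming-outcome≡Deal : outcome G C s₀ ≡ Deal G C
    conforming-outcome≡Deal = trans (cong (outcome G C) (live⇒conforming-state≡⊤ live exec₀)) (outcome-⊤ G C)

lemma1 : (G : SwapDigraph) → StronglyConnected G →
         (P : Protocol G) → Live G P → Safe G P → Atomic G P
lemma1 G sc P live safe = live , safe , strongNash P sc live safe
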